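{- For $n\ge2$, $$\sum_{\pi\in\mathrm{PF}(n)}x^{\mathrm{lel}(\pi)}y^{\mathrm{nlel}(\pi)}z^{\mathrm{unl}(\pi)}=xy\Big(n\prod_{i=1}^{n-2}\big(xz+yz+(i-1)z+n-i\big)+xyz\prod_{i=1}^{n-2}\big(xyz+iz+n-i\big)\Big).$$
   Context: $\mathrm{PF}(n)$ is the set of parking functions of length $n$: sequences of positive integers whose increasing rearrangement $b_1\le\dots\le b_n$ satisfies $b_i\le i$; equivalently all cars park under the classical protocol (cars $1,\dots,n$ arrive in order, car $i$ parks in the first unoccupied spot among $\pi_i,\pi_i+1,\dots,n$). $\mathrm{unl}(\pi)$ is the number of cars not parking in their preferred spot, $\mathrm{lel}(\pi)=\#\{i:\pi_i=\pi_1\}$, $\mathrm{nlel}(\pi)=\#\{i:\pi_i=\pi_2\}$. -}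

module Defs where

open import Level using (Level)
open import Data.Nat using (ℕ; zero; suc; _∸_; _≡ᵇ_)
open import Data.Bool using (Bool; true; false; if_then_else_; not)
open import Data.Maybe using (Maybe; just; nothing)
open import Data.List using (List; []; _∷_; map; concatMap; foldr; length; filter)
open import Data.Bool.ListAction using (any)
open import Data.List using () renaming (upTo to upTo′)
open import Algebra.Bundles using (CommutativeSemiring)
import Algebra.Definitions.RawSemiring as RS

-- Preference sequences are lists of positive integers (spots are 1..n).

oneTo : ℕ → List ℕ
oneTo n = map suc (upTo′ n)

seqs : ℕ → ℕ → List (List ℕ)
seqs n zero = [] ∷ []
seqs n (suc k) = concatMap (λ a → map (a ∷_) (seqs n k)) (oneTo n)

occupied : ℕ → List ℕ → Bool
occupied s occ = any (s ≡ᵇ_) occ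

search : List ℕ → ℕ → ℕ → Maybe ℕ
search occ s zero = nothing
search occ s (suc k) = if occupied s occ then search occ (suc s) k else just s

parkFrom : ℕ → List ℕ → List ℕ → Maybe (List ℕ)
parkFrom n occ [] = just []
parkFrom n occ (p ∷ ps) with search occ p (suc n ∸ p)
... | nothing = nothing
... | just s with parkFrom n (s ∷ occ) ps
...   | nothing = nothing
...   | just ss = just (s ∷ ss)

park : ℕ → List ℕ → Maybe (List ℕ)
park n π = parkFrom n [] π

parks : ℕ → List ℕ → Bool
parks n π with park n π
... | just _ = true
... | nothing = false

-- PF(n): all length-n preference sequences (entries in 1..n; larger
-- preferences can never park) for which all cars park.
PF : ℕ → List (List ℕ)
PF n = filter (λ π → Data.Bool.T? (parks n π)) (seqs n n)
  where import Data.Bool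

count : (ℕ → Bool) → List ℕ → ℕ
count f [] = 0
count f (a ∷ as) = if f a then suc (count f as) else count f as

countDiff : List ℕ → List ℕ → ℕ
countDiff (p ∷ ps) (s ∷ ss) = if p ≡ᵇ s then countDiff ps ss else suc (countDiff ps ss)
countDiff _ _ = 0

unl : ℕ → List ℕ → ℕ
unl n π with park n π
... | just ss = countDiff π ss
... | nothing = 0

lel : List ℕ → ℕ
lel [] = 0
lel (a ∷ as) = count (a ≡ᵇ_) (a ∷ as)

nlel : List ℕ → ℕ
nlel (a ∷ b ∷ rest) = count (b ≡ᵇ_) (a ∷ b ∷ rest)
nlel _ = 0

module Poly {c ℓ : Level} (R : CommutativeSemiring c ℓ) where
  open CommutativeSemiring R
  open RS rawSemiring public using (_×_; _^_)

  sumL : List Carrier → Carrier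
  sumL = foldr _+_ 0#

  prodTo : ℕ → (ℕ → Carrier) → Carrier
  prodTo zero f = 1#
  prodTo (suc m) f = prodTo m f * f (suc m)

  nat : ℕ → Carrier
  nat k = k × 1#

  genPF : ℕ → Carrier → Carrier → Carrier → Carrier
  genPF n x y z = sumL (map (λ π → (x ^ lel π) * (y ^ nlel π) * (z ^ unl n π)) (PF n))

  rhs : ℕ → Carrier → Carrier → Carrier → Carrier
  rhs n x y z =
    x * y * ( nat n * prodTo (n ∸ 2) (λ i → x * z + y * z + nat (i ∸ 1) * z + nat (n ∸ i))
            + x * y * z * prodTo (n ∸ 2) (λ i → x * y * z + nat i * z + nat (n ∸ i)))

-- Pollak's circular argument.  Add a spot N = n + 1 and let the cars park on a circle of N spots, a car whose
-- preferred spot is taken trying the following spots cyclically.  Every sequence in [N]ⁿ then parks leaving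
-- exactly one spot empty; a sequence in [n]ⁿ is a parking function exactly when it leaves spot N empty, and then
-- its unlucky cars are the same on the line and on the circle, while sequences using spot N never leave it empty.
-- Rotating all preferences by one spot rotates the outcome and preserves lel, nlel and unl, so exchanging the roles
-- of the first car's preference and of the empty spot turns the weighted count of the sequences leaving N empty
-- into the weighted count of all sequences whose first car prefers spot 1.  Once the first two cars have parked,
-- the weight of a further car summed over its preference depends only on how many spots are taken: x z or y z for
-- the spots of cars 1 and 2, z for every other taken spot and 1 for every free one.  This gives the two products,
-- according to whether car 2 also prefers spot 1 or one of the n other spots.

module Submission where

open import Defs
open import Level using (Level)
open import Data.Nat using (ℕ; suc; _≤_; s≤s)
open import Data.List using (_∷_)
open import Algebra.Bundles using (CommutativeSemiring)

module Parking where

  open import Data.Nat using (zero; suc; _+_; _∸_; _≡ᵇ_; _<_; z≤n; s≤s)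
  open import Data.Nat.Properties
  open import Data.Bool using (Bool; true; false; if_then_else_; not; _∧_; _∨_; T)
  open import Data.Bool.Properties using (∨-zeroʳ; ∧-zeroʳ)
  open import Data.Bool.ListAction using (any)
  open import Data.Maybe using (Maybe; just; nothing)
  open import Data.Maybe.Properties using (just-injective)
  open import Data.List using (List; []; map; _++_; length; upTo; applyUpTo; reverse; [_])
  open import Data.List.Properties using (map-++; map-∘; length-map; length-upTo; upTo-∷ʳ; map-applyUpTo; reverse-++)
  open import Data.List.Relation.Unary.All as All using (All; _∷_)
  import Data.List.Relation.Unary.All.Properties as All
  open import Data.Product using (∃; _×_; _,_; proj₁; proj₂)
  open import Data.Empty using (⊥-elim)
  open import Data.Unit using (⊤; tt)
  open import Function using (_∘_; id)
  open import Relation.Nullary using (yes; no)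
  open import Relation.Binary.PropositionalEquality hiding ([_]; setoid)

  bit : Bool → ℕ
  bit true = 1
  bit false = 0

  ≡ᵇ-refl : ∀ a → (a ≡ᵇ a) ≡ true
  ≡ᵇ-refl zero = refl
  ≡ᵇ-refl (suc a) = ≡ᵇ-refl a

  ≡ᵇ-true⇒≡ : ∀ a b → (a ≡ᵇ b) ≡ true → a ≡ b
  ≡ᵇ-true⇒≡ a b e = ≡ᵇ⇒≡ a b (subst T (sym e) tt)

  ≢⇒≡ᵇ-false : ∀ {a b} → a ≢ b → (a ≡ᵇ b) ≡ false
  ≢⇒≡ᵇ-false {a} {b} a≢b with a ≡ᵇ b in e
  ... | false = refl
  ... | true = ⊥-elim (a≢b (≡ᵇ-true⇒≡ a b e))

  ≡ᵇ-sym : ∀ a b → (a ≡ᵇ b) ≡ (b ≡ᵇ a)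
  ≡ᵇ-sym a b with a ≟ b
  ... | yes refl = refl
  ... | no a≢b = trans (≢⇒≡ᵇ-false a≢b) (sym (≢⇒≡ᵇ-false (a≢b ∘ sym)))

  ≡ᵇ-injective : (f : ℕ → ℕ) → (∀ a b → f a ≡ f b → a ≡ b) → ∀ a b → (f a ≡ᵇ f b) ≡ (a ≡ᵇ b)
  ≡ᵇ-injective f f-inj a b with a ≟ b
  ... | yes refl = trans (≡ᵇ-refl (f a)) (sym (≡ᵇ-refl a))
  ... | no a≢b = trans (≢⇒≡ᵇ-false (a≢b ∘ f-inj a b)) (sym (≢⇒≡ᵇ-false a≢b))

  count-cong : ∀ {f g} (L : List ℕ) → (∀ t → f t ≡ g t) → count f L ≡ count g L
  count-cong [] f≗g = refl
  count-cong {f} {g} (a ∷ L) f≗g rewrite f≗g a with g a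
  ... | true = cong suc (count-cong L f≗g)
  ... | false = count-cong L f≗g

  count-∷ : ∀ (f : ℕ → Bool) a (L : List ℕ) → count f (a ∷ L) ≡ bit (f a) + count f L
  count-∷ f a L with f a
  ... | true = refl
  ... | false = refl

  count-++ : ∀ (f : ℕ → Bool) (L M : List ℕ) → count f (L ++ M) ≡ count f L + count f M
  count-++ f [] M = refl
  count-++ f (a ∷ L) M with f a
  ... | true = cong suc (count-++ f L M)
  ... | false = count-++ f L M

  count-false : ∀ (L : List ℕ) → count (λ _ → false) L ≡ 0
  count-false [] = refl
  count-false (a ∷ L) = count-false L

  count+count-not : ∀ (f : ℕ → Bool) (L : List ℕ) → count f L + count (not ∘ f) L ≡ length L
  count+count-not f [] = refl
  count+count-not f (a ∷ L) with f a
  ... | true = cong suc (count+count-not f L)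
  ... | false = trans (+-suc (count f L) _) (cong suc (count+count-not f L))

  count-∧+count-∧-not : ∀ (f g : ℕ → Bool) (L : List ℕ) →
    count (λ t → f t ∧ g t) L + count (λ t → f t ∧ not (g t)) L ≡ count f L
  count-∧+count-∧-not f g [] = refl
  count-∧+count-∧-not f g (a ∷ L) with f a | g a
  ... | true | true = cong suc (count-∧+count-∧-not f g L)
  ... | true | false = trans (+-suc _ _) (cong suc (count-∧+count-∧-not f g L))
  ... | false | _ = count-∧+count-∧-not f g L

  count-∨-disjoint : ∀ (f g : ℕ → Bool) (L : List ℕ) → (∀ t → f t ≡ true → g t ≡ false) →
    count (λ t → f t ∨ g t) L ≡ count f L + count g L
  count-∨-disjoint f g [] _ = refl
  count-∨-disjoint f g (a ∷ L) disj with f a in fa | g a in ga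
  ... | true | true with () ← trans (sym ga) (disj a fa)
  ... | true | false = cong suc (count-∨-disjoint f g L disj)
  ... | false | true = trans (cong suc (count-∨-disjoint f g L disj)) (sym (+-suc _ _))
  ... | false | false = count-∨-disjoint f g L disj

  count-map : ∀ (f : ℕ → Bool) (g : ℕ → ℕ) L → count f (map g L) ≡ count (f ∘ g) L
  count-map f g [] = refl
  count-map f g (a ∷ L) with f (g a)
  ... | true = cong suc (count-map f g L)
  ... | false = count-map f g L

  InRange : ℕ → ℕ → Set
  InRange n s = 1 ≤ s × s ≤ n

  oneTo-suc : ∀ m → oneTo (suc m) ≡ 1 ∷ map suc (oneTo m)
  oneTo-suc m = cong (1 ∷_) (begin
    map suc (applyUpTo suc m)          ≡⟨ map-applyUpTo suc suc m ⟩
    applyUpTo (suc ∘ suc) m            ≡⟨ map-applyUpTo id (suc ∘ suc) m ⟨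
    map (suc ∘ suc) (upTo m)           ≡⟨ map-∘ (upTo m) ⟩
    map suc (oneTo m)                  ∎)
    where open ≡-Reasoning

  oneTo-∷ʳ : ∀ m → oneTo (suc m) ≡ oneTo m ++ [ suc m ]
  oneTo-∷ʳ m = trans (cong (map suc) (sym (upTo-∷ʳ m))) (map-++ suc (upTo m) [ m ])

  length-oneTo : ∀ m → length (oneTo m) ≡ m
  length-oneTo m = trans (length-map suc (upTo m)) (length-upTo m)

  oneTo-inRange : ∀ m → All (InRange m) (oneTo m)
  oneTo-inRange m = All.map⁺ (All.applyUpTo⁺₁ id m (λ i<m → s≤s z≤n , i<m))

  count-≡ᵇ-oneTo : ∀ m a → InRange m a → count (a ≡ᵇ_) (oneTo m) ≡ 1
  count-≡ᵇ-oneTo m zero (() , _)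
  count-≡ᵇ-oneTo zero (suc a) (_ , ())
  count-≡ᵇ-oneTo (suc m) a a∈ = trans (cong (count (a ≡ᵇ_)) (oneTo-suc m)) (shifted a a∈)
    where
    shifted : ∀ a → InRange (suc m) a → count (a ≡ᵇ_) (1 ∷ map suc (oneTo m)) ≡ 1
    shifted 1 _ = cong suc (trans (count-map _ suc (oneTo m)) (trans (count-map _ suc (upTo m)) (count-false (upTo m))))
    shifted (suc (suc a)) (_ , s≤s a<m) = trans (count-map _ suc (oneTo m)) (count-≡ᵇ-oneTo m (suc a) (s≤s z≤n , a<m))

  upTo-reflect : ∀ K → map (K ∸_) (upTo K) ≡ reverse (oneTo K)
  upTo-reflect zero = refl
  upTo-reflect (suc K) = begin
    suc K ∷ map (suc K ∸_) (applyUpTo suc K) ≡⟨ cong (suc K ∷_) (map-applyUpTo suc (suc K ∸_) K) ⟩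
    suc K ∷ applyUpTo (K ∸_) K               ≡⟨ cong (suc K ∷_) (map-applyUpTo id (K ∸_) K) ⟨
    suc K ∷ map (K ∸_) (upTo K)              ≡⟨ cong (suc K ∷_) (upTo-reflect K) ⟩
    suc K ∷ reverse (oneTo K)                ≡⟨ reverse-++ (oneTo K) [ suc K ] ⟨
    reverse (oneTo K ++ [ suc K ])           ≡⟨ cong reverse (oneTo-∷ʳ K) ⟨
    reverse (oneTo (suc K))                  ∎
    where open ≡-Reasoning

  Distinct : List ℕ → Set
  Distinct [] = ⊤
  Distinct (s ∷ o) = occupied s o ≡ false × Distinct o

  occupied-∷ : ∀ t s o → occupied t o ≡ true → occupied t (s ∷ o) ≡ true
  occupied-∷ t s o t∈o = trans (cong ((t ≡ᵇ s) ∨_) t∈o) (∨-zeroʳ _)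

  occupied-≡ᵇ : ∀ a p o → (a ≡ᵇ p) ≡ true → occupied a o ≡ true → occupied p o ≡ true
  occupied-≡ᵇ a p o a≡p a∈o rewrite ≡ᵇ-true⇒≡ a p a≡p = a∈o

  occupied⇒inRange : ∀ {n} t o → occupied t o ≡ true → All (InRange n) o → InRange n t
  occupied⇒inRange t (s ∷ o) t∈ (s∈ ∷ o∈) with t ≡ᵇ s in t≡s
  ... | true rewrite ≡ᵇ-true⇒≡ t s t≡s = s∈
  ... | false = occupied⇒inRange t o t∈ o∈

  count-occupied-oneTo : ∀ n o → Distinct o → All (InRange n) o → count (λ t → occupied t o) (oneTo n) ≡ length o
  count-occupied-oneTo n [] _ _ = count-false (oneTo n)
  count-occupied-oneTo n (s ∷ o) (s∉o , o-distinct) (s∈ ∷ o∈) = begin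
    count (λ t → (t ≡ᵇ s) ∨ occupied t o) (oneTo n)
      ≡⟨ count-∨-disjoint (_≡ᵇ s) (λ t → occupied t o) (oneTo n) disjoint ⟩
    count (_≡ᵇ s) (oneTo n) + count (λ t → occupied t o) (oneTo n)
      ≡⟨ cong₂ _+_ (trans (count-cong (oneTo n) (λ t → ≡ᵇ-sym t s)) (count-≡ᵇ-oneTo n s s∈))
                   (count-occupied-oneTo n o o-distinct o∈) ⟩
    suc (length o)
      ∎
    where
    open ≡-Reasoning
    disjoint : ∀ t → (t ≡ᵇ s) ≡ true → occupied t o ≡ false
    disjoint t t≡s rewrite ≡ᵇ-true⇒≡ t s t≡s = s∉o

  count-free-oneTo : ∀ n o → Distinct o → All (InRange n) o → count (λ t → not (occupied t o)) (oneTo n) ≡ n ∸ length o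
  count-free-oneTo n o o-distinct o∈ = begin
    free                                                    ≡⟨ m+n∸m≡n (length o) free ⟨
    length o + free ∸ length o                              ≡⟨ cong (λ k → k + free ∸ length o) (count-occupied-oneTo n o o-distinct o∈) ⟨
    count (λ t → occupied t o) (oneTo n) + free ∸ length o  ≡⟨ cong (_∸ length o) (count+count-not (λ t → occupied t o) (oneTo n)) ⟩
    length (oneTo n) ∸ length o                             ≡⟨ cong (_∸ length o) (length-oneTo n) ⟩
    n ∸ length o                                            ∎
    where
    open ≡-Reasoning
    free : ℕ
    free = count (λ t → not (occupied t o)) (oneTo n)

  count<length⇒∃-false : ∀ {P : ℕ → Set} (f : ℕ → Bool) L → count f L < length L → All P L → ∃ λ t → P t × f t ≡ false
  count<length⇒∃-false f (a ∷ L) c<l (Pa ∷ PL) with f a in fa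
  ... | false = a , Pa , fa
  ... | true = count<length⇒∃-false f L (≤-pred c<l) PL

  count-remove : ∀ (f : ℕ → Bool) a L → f a ≡ true → count (a ≡ᵇ_) L ≡ 1 →
    count (λ p → f p ∧ not (a ≡ᵇ p)) L ≡ count f L ∸ 1
  count-remove f a L fa once = begin
    rest                                       ≡⟨ m+n∸m≡n 1 rest ⟨
    1 + rest ∸ 1                               ≡⟨ cong (λ k → k + rest ∸ 1) a-counted ⟨
    count (λ p → f p ∧ (a ≡ᵇ p)) L + rest ∸ 1  ≡⟨ cong (_∸ 1) (count-∧+count-∧-not f (a ≡ᵇ_) L) ⟩
    count f L ∸ 1                              ∎
    where
    open ≡-Reasoning
    rest : ℕ
    rest = count (λ p → f p ∧ not (a ≡ᵇ p)) L
    at-a : ∀ p → (f p ∧ (a ≡ᵇ p)) ≡ (a ≡ᵇ p)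
    at-a p with a ≡ᵇ p in a≡p
    ... | false = ∧-zeroʳ _
    ... | true rewrite sym (≡ᵇ-true⇒≡ a p a≡p) | fa = refl
    a-counted : count (λ p → f p ∧ (a ≡ᵇ p)) L ≡ 1
    a-counted = trans (count-cong L at-a) once

  count-occupied-except : ∀ n o a → Distinct o → All (InRange n) o → occupied a o ≡ true →
    count (λ p → occupied p o ∧ not (a ≡ᵇ p)) (oneTo n) ≡ length o ∸ 1
  count-occupied-except n o a o-distinct o∈ a∈o =
    trans (count-remove (λ p → occupied p o) a (oneTo n) a∈o (count-≡ᵇ-oneTo n a (occupied⇒inRange a o a∈o o∈)))
          (cong (_∸ 1) (count-occupied-oneTo n o o-distinct o∈))

  count-occupied-except₂ : ∀ n o a b → Distinct o → All (InRange n) o → occupied a o ≡ true → occupied b o ≡ true → a ≢ b →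
    count (λ p → (occupied p o ∧ not (a ≡ᵇ p)) ∧ not (b ≡ᵇ p)) (oneTo n) ≡ length o ∸ 2
  count-occupied-except₂ n o a b o-distinct o∈ a∈o b∈o a≢b =
    trans (count-remove (λ p → occupied p o ∧ not (a ≡ᵇ p)) b (oneTo n) b-kept (count-≡ᵇ-oneTo n b (occupied⇒inRange b o b∈o o∈)))
          (trans (cong (_∸ 1) (count-occupied-except n o a o-distinct o∈ a∈o)) (∸-+-assoc (length o) 1 1))
    where
    b-kept : (occupied b o ∧ not (a ≡ᵇ b)) ≡ true
    b-kept rewrite b∈o | ≢⇒≡ᵇ-false a≢b = refl

  search-bounds : ∀ o p k s → search o p k ≡ just s → p ≤ s × s < p + k
  search-bounds o p (suc k) s found with occupied p o
  ... | true = let p<s , s<p+k = search-bounds o (suc p) k s found in ≤-trans (n≤1+n p) p<s , subst (s <_) (sym (+-suc p k)) s<p+k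
  ... | false rewrite just-injective found = ≤-refl , subst (s <_) (sym (+-suc s k)) (s≤s (m≤m+n s k))

  search-lucky : ∀ o p k s → search o p k ≡ just s → (p ≡ᵇ s) ≡ not (occupied p o)
  search-lucky o p (suc k) s found with occupied p o
  ... | true = ≢⇒≡ᵇ-false (λ p≡s → <-irrefl p≡s (proj₁ (search-bounds o (suc p) k s found)))
  ... | false rewrite just-injective found = ≡ᵇ-refl s

  countDiff-∷ : ∀ p s ps ss b → (p ≡ᵇ s) ≡ not b → countDiff (p ∷ ps) (s ∷ ss) ≡ bit b + countDiff ps ss
  countDiff-∷ p s ps ss true lucky rewrite lucky = refl
  countDiff-∷ p s ps ss false lucky rewrite lucky = refl

  module Circle (M : ℕ) where

    N : ℕ
    N = suc M

    -- s ↦ s + 1 on the spots 1, …, N, with N ↦ 1; every other number is fixed, so this is a bijection of ℕ.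
    rotate : ℕ → ℕ
    rotate zero = zero
    rotate (suc s) with suc s ≟ N
    ... | yes _ = 1
    ... | no _ with suc s <? N
    ...   | yes _ = suc (suc s)
    ...   | no _ = suc s

    unrotate : ℕ → ℕ
    unrotate zero = zero
    unrotate (suc zero) = N
    unrotate (suc (suc s)) with suc (suc s) ≤? N
    ... | yes _ = suc s
    ... | no _ = suc (suc s)

    unrotate-rotate : ∀ s → unrotate (rotate s) ≡ s
    unrotate-rotate zero = refl
    unrotate-rotate (suc s) with suc s ≟ N
    ... | yes s≡N = sym s≡N
    ... | no s≢N with suc s <? N
    ...   | yes s<N with suc (suc s) ≤? N
    ...     | yes _ = refl
    ...     | no s≮N = ⊥-elim (s≮N s<N)
    unrotate-rotate (suc zero) | no s≢N | no s≮N = ⊥-elim (s≮N (≤∧≢⇒< (s≤s z≤n) s≢N))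
    unrotate-rotate (suc (suc s)) | no s≢N | no s≮N with suc (suc s) ≤? N
    ... | yes s≤N = ⊥-elim (s≮N (≤∧≢⇒< s≤N s≢N))
    ... | no _ = refl

    rotate-injective : ∀ a b → rotate a ≡ rotate b → a ≡ b
    rotate-injective a b eq = trans (sym (unrotate-rotate a)) (trans (cong unrotate eq) (unrotate-rotate b))

    rotate-N : rotate N ≡ 1
    rotate-N with N ≟ N
    ... | yes _ = refl
    ... | no N≢N = ⊥-elim (N≢N refl)

    rotate-<N : ∀ s → 1 ≤ s → s < N → rotate s ≡ suc s
    rotate-<N (suc s) _ s<N with suc s ≟ N
    ... | yes s≡N = ⊥-elim (<-irrefl s≡N s<N)
    ... | no _ with suc s <? N
    ...   | yes _ = refl
    ...   | no s≮N = ⊥-elim (s≮N s<N)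

    rotate-inRange : ∀ s → InRange N s → InRange N (rotate s)
    rotate-inRange s (1≤s , s≤N) with s ≟ N
    ... | yes refl rewrite rotate-N = s≤s z≤n , s≤s z≤n
    ... | no s≢N rewrite rotate-<N s 1≤s (≤∧≢⇒< s≤N s≢N) = s≤s z≤n , ≤∧≢⇒< s≤N s≢N

    rotate^ : ℕ → ℕ → ℕ
    rotate^ zero s = s
    rotate^ (suc j) s = rotate (rotate^ j s)

    rotate^-rotate : ∀ j s → rotate^ j (rotate s) ≡ rotate (rotate^ j s)
    rotate^-rotate zero s = refl
    rotate^-rotate (suc j) s = cong rotate (rotate^-rotate j s)

    rotate^-+ : ∀ i j s → rotate^ (i + j) s ≡ rotate^ i (rotate^ j s)
    rotate^-+ zero j s = refl
    rotate^-+ (suc i) j s = cong rotate (rotate^-+ i j s)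

    rotate^-inRange : ∀ j s → InRange N s → InRange N (rotate^ j s)
    rotate^-inRange zero s s∈ = s∈
    rotate^-inRange (suc j) s s∈ = rotate-inRange _ (rotate^-inRange j s s∈)

    rotate^-without-wrap : ∀ i s → 1 ≤ s → s + i ≤ N → rotate^ i s ≡ s + i
    rotate^-without-wrap zero s _ _ = sym (+-identityʳ s)
    rotate^-without-wrap (suc i) s 1≤s s+i≤N = begin
      rotate (rotate^ i s) ≡⟨ cong rotate (rotate^-without-wrap i s 1≤s (≤-trans (+-monoʳ-≤ s (n≤1+n i)) s+i≤N)) ⟩
      rotate (s + i)       ≡⟨ rotate-<N (s + i) (≤-trans 1≤s (m≤m+n s i)) (subst (_≤ N) (+-suc s i) s+i≤N) ⟩
      suc (s + i)          ≡⟨ +-suc s i ⟨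
      s + suc i            ∎
      where open ≡-Reasoning

    rotate-orbit : ∀ s t → InRange N s → InRange N t → ∃ λ j → j < N × rotate^ j s ≡ t
    rotate-orbit (suc s) (suc t) (1≤s , s≤N) (_ , t≤N) with suc s ≤? suc t
    ... | yes s≤t = suc t ∸ suc s , s≤s (≤-trans (m∸n≤m t s) (≤-pred t≤N)) ,
          trans (rotate^-without-wrap _ (suc s) 1≤s (subst (_≤ N) (sym (m+[n∸m]≡n s≤t)) t≤N)) (m+[n∸m]≡n s≤t)
    ... | no s≰t = t + suc (N ∸ suc s) , wrap<N , wrap-lands
      where
      [s+[N∸s]]≡N : suc s + (N ∸ suc s) ≡ N
      [s+[N∸s]]≡N = m+[n∸m]≡n s≤N
      wrap<N : t + suc (N ∸ suc s) < N
      wrap<N = begin-strict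
        t + suc (N ∸ suc s)   ≡⟨ +-suc t _ ⟩
        suc t + (N ∸ suc s)   <⟨ +-monoˡ-< (N ∸ suc s) (≰⇒> s≰t) ⟩
        suc s + (N ∸ suc s)   ≡⟨ [s+[N∸s]]≡N ⟩
        N                     ∎
        where open ≤-Reasoning
      s↦N : rotate^ (N ∸ suc s) (suc s) ≡ N
      s↦N = trans (rotate^-without-wrap _ (suc s) 1≤s (≤-reflexive [s+[N∸s]]≡N)) [s+[N∸s]]≡N
      wrap-lands : rotate^ (t + suc (N ∸ suc s)) (suc s) ≡ suc t
      wrap-lands = begin
        rotate^ (t + suc (N ∸ suc s)) (suc s)                  ≡⟨ rotate^-+ t (suc (N ∸ suc s)) (suc s) ⟩
        rotate^ t (rotate (rotate^ (N ∸ suc s) (suc s)))     ≡⟨ cong (rotate^ t ∘ rotate) s↦N ⟩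
        rotate^ t (rotate N)                                  ≡⟨ cong (rotate^ t) rotate-N ⟩
        rotate^ t 1                                           ≡⟨ rotate^-without-wrap t 1 (s≤s z≤n) t≤N ⟩
        suc t                                                 ∎
        where open ≡-Reasoning

    occupied-rotate : ∀ s o → occupied (rotate s) (map rotate o) ≡ occupied s o
    occupied-rotate s [] = refl
    occupied-rotate s (a ∷ o) = cong₂ _∨_ (≡ᵇ-injective rotate rotate-injective s a) (occupied-rotate s o)

    -- The first free spot among p, rotate p, …, rotate^(k-1) p.  The junk value 0 is never returned by parkSpot
    -- while a spot is free, since N steps visit every spot.
    circularSearch : List ℕ → ℕ → ℕ → ℕ
    circularSearch o p zero = 0
    circularSearch o p (suc k) = if occupied p o then circularSearch o (rotate p) k else p

    parkSpot : List ℕ → ℕ → ℕ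
    parkSpot o p = circularSearch o p N

    circularPark : List ℕ → List ℕ → List ℕ
    circularPark o [] = o
    circularPark o (p ∷ ps) = circularPark (parkSpot o p ∷ o) ps

    circularUnlucky : List ℕ → List ℕ → ℕ
    circularUnlucky o [] = 0
    circularUnlucky o (p ∷ ps) = bit (occupied p o) + circularUnlucky (parkSpot o p ∷ o) ps

    circularSearch-rotate : ∀ o p k → circularSearch (map rotate o) (rotate p) k ≡ rotate (circularSearch o p k)
    circularSearch-rotate o p zero = refl
    circularSearch-rotate o p (suc k) rewrite occupied-rotate p o with occupied p o
    ... | true = circularSearch-rotate o (rotate p) k
    ... | false = refl

    circularPark-rotate : ∀ o σ → circularPark (map rotate o) (map rotate σ) ≡ map rotate (circularPark o σ)
    circularPark-rotate o [] = refl
    circularPark-rotate o (p ∷ ps) rewrite circularSearch-rotate o p N = circularPark-rotate (parkSpot o p ∷ o) ps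

    circularUnlucky-rotate : ∀ o σ → circularUnlucky (map rotate o) (map rotate σ) ≡ circularUnlucky o σ
    circularUnlucky-rotate o [] = refl
    circularUnlucky-rotate o (p ∷ ps) rewrite circularSearch-rotate o p N | occupied-rotate p o =
      cong (bit (occupied p o) +_) (circularUnlucky-rotate (parkSpot o p ∷ o) ps)

    count-rotate : ∀ a σ → count (rotate a ≡ᵇ_) (map rotate σ) ≡ count (a ≡ᵇ_) σ
    count-rotate a σ = trans (count-map _ rotate σ) (count-cong σ (≡ᵇ-injective rotate rotate-injective a))

    lel-rotate : ∀ σ → lel (map rotate σ) ≡ lel σ
    lel-rotate [] = refl
    lel-rotate (a ∷ σ) = count-rotate a (a ∷ σ)

    nlel-rotate : ∀ σ → nlel (map rotate σ) ≡ nlel σ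
    nlel-rotate [] = refl
    nlel-rotate (a ∷ []) = refl
    nlel-rotate (a ∷ b ∷ σ) = count-rotate b (a ∷ b ∷ σ)

    ValidOccupancy : List ℕ → Set
    ValidOccupancy o = Distinct o × All (InRange N) o

    circularSearch-free : ∀ k j p o → j < k → occupied (rotate^ j p) o ≡ false →
      ∃ λ i → circularSearch o p k ≡ rotate^ i p × occupied (rotate^ i p) o ≡ false
    circularSearch-free (suc k) j p o j<k free with occupied p o in p-free
    ... | false = 0 , refl , p-free
    circularSearch-free (suc k) zero p o j<k free | true with () ← trans (sym free) p-free
    circularSearch-free (suc k) (suc j) p o (s≤s j<k) free | true
      with circularSearch-free k j (rotate p) o j<k (trans (cong (λ u → occupied u o) (rotate^-rotate j p)) free)
    ... | i , found , i-free = suc i , trans found (rotate^-rotate i p) ,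
                               trans (cong (λ u → occupied u o) (sym (rotate^-rotate i p))) i-free

    parkSpot-free : ∀ o p → ValidOccupancy o → length o < N → InRange N p →
      InRange N (parkSpot o p) × occupied (parkSpot o p) o ≡ false
    parkSpot-free o p (o-distinct , o∈) o<N p∈
      with count<length⇒∃-false (λ t → occupied t o) (oneTo N)
             (subst₂ _<_ (sym (count-occupied-oneTo N o o-distinct o∈)) (sym (length-oneTo N)) o<N) (oneTo-inRange N)
    ... | t , t∈ , t-free with rotate-orbit p t p∈ t∈
    ... | j , j<N , p↦t with circularSearch-free N j p o j<N (trans (cong (λ u → occupied u o) p↦t) t-free)
    ... | i , found , i-free = subst (InRange N) (sym found) (rotate^-inRange i p p∈) ,
                               trans (cong (λ u → occupied u o) found) i-free

    circularPark-valid : ∀ o σ → ValidOccupancy o → All (InRange N) σ → length o + length σ ≤ N →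
      ValidOccupancy (circularPark o σ) × length (circularPark o σ) ≡ length o + length σ
    circularPark-valid o [] o-valid _ _ = o-valid , sym (+-identityʳ _)
    circularPark-valid o (p ∷ ps) o-valid@(o-distinct , o∈) (p∈ ∷ ps∈) fits =
      let s∈ , s-free = parkSpot-free o p o-valid o<N p∈
          valid , len = circularPark-valid (parkSpot o p ∷ o) ps ((s-free , o-distinct) , (s∈ ∷ o∈)) ps∈ fits′
      in valid , trans len (sym (+-suc _ _))
      where
      fits′ : suc (length o) + length ps ≤ N
      fits′ = subst (_≤ N) (+-suc (length o) (length ps)) fits
      o<N : length o < N
      o<N = ≤-trans (s≤s (m≤m+n (length o) (length ps))) fits′

    circularPark-monotone : ∀ t o σ → occupied t o ≡ true → occupied t (circularPark o σ) ≡ true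
    circularPark-monotone t o [] t∈o = t∈o
    circularPark-monotone t o (p ∷ ps) t∈o = circularPark-monotone t (parkSpot o p ∷ o) ps (occupied-∷ t _ o t∈o)

    preferring-N-occupies-N : ∀ o σ → any (N ≡ᵇ_) σ ≡ true → occupied N (circularPark o σ) ≡ true
    preferring-N-occupies-N o (p ∷ ps) N∈σ with N ≡ᵇ p in N≡p
    ... | false = preferring-N-occupies-N (parkSpot o p ∷ o) ps N∈σ
    ... | true rewrite sym (≡ᵇ-true⇒≡ N p N≡p) = circularPark-monotone N (parkSpot o N ∷ o) ps N-taken
      where
      N-taken : occupied N (parkSpot o N ∷ o) ≡ true
      N-taken with occupied N o in N∈o
      ... | true = ∨-zeroʳ _
      ... | false rewrite ≡ᵇ-refl N = refl

    search⇒circularSearch : ∀ o p k s → search o p k ≡ just s → 1 ≤ p → p + k ≤ N → ∀ f → k ≤ f → circularSearch o p f ≡ s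
    search⇒circularSearch o p (suc k) s found 1≤p p+k≤N (suc f) (s≤s k≤f) with occupied p o
    ... | true rewrite rotate-<N p 1≤p (≤-trans (s≤s (m≤m+n p k)) (subst (_≤ N) (+-suc p k) p+k≤N)) =
          search⇒circularSearch o (suc p) k s found (s≤s z≤n) (subst (_≤ N) (+-suc p k) p+k≤N) f k≤f
    ... | false = just-injective found

    search-fails⇒circularSearch : ∀ o p k → search o p k ≡ nothing → 1 ≤ p → p + k ≡ N → occupied N o ≡ false →
      ∀ f → k < f → circularSearch o p f ≡ N
    search-fails⇒circularSearch o p zero _ _ p≡N N-free (suc f) _ rewrite +-identityʳ p | p≡N | N-free = refl
    search-fails⇒circularSearch o p (suc k) fails 1≤p p+k≡N N-free (suc f) (s≤s k<f) with occupied p o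
    ... | true rewrite rotate-<N p 1≤p (subst (suc p ≤_) p+k≡N (subst (suc p ≤_) (sym (+-suc p k)) (s≤s (m≤m+n p k)))) =
          search-fails⇒circularSearch o (suc p) k fails (s≤s z≤n) (trans (sym (+-suc p k)) p+k≡N) N-free f k<f
    ... | false with () ← fails

    parkSpot-search : ∀ o p s → 1 ≤ p → p ≤ M → search o p (N ∸ p) ≡ just s → parkSpot o p ≡ s
    parkSpot-search o p s 1≤p p≤M found =
      search⇒circularSearch o p (N ∸ p) s found 1≤p (≤-reflexive (m+[n∸m]≡n (m≤n⇒m≤1+n p≤M))) N (m∸n≤m N p)

    parkSpot-search-fails : ∀ o p → 1 ≤ p → p ≤ M → occupied N o ≡ false → search o p (N ∸ p) ≡ nothing → parkSpot o p ≡ N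
    parkSpot-search-fails o (suc p) 1≤p p≤M N-free fails =
      search-fails⇒circularSearch o (suc p) (N ∸ suc p) fails 1≤p (m+[n∸m]≡n (m≤n⇒m≤1+n p≤M)) N-free N (s≤s (m∸n≤m M p))

    data LinearAgreement (o σ : List ℕ) : Maybe (List ℕ) → Set where
      parked : ∀ {ss} → countDiff σ ss ≡ circularUnlucky o σ → occupied N (circularPark o σ) ≡ false →
               LinearAgreement o σ (just ss)
      stuck  : occupied N (circularPark o σ) ≡ true → LinearAgreement o σ nothing

    -- Linear parking on 1, …, M is circular parking on 1, …, N that fails exactly when some car reaches spot N.
    linear≈circular : ∀ o σ → occupied N o ≡ false → All (InRange M) σ → LinearAgreement o σ (parkFrom M o σ)
    linear≈circular o [] N-free _ = parked refl N-free
    linear≈circular o (p ∷ ps) N-free ((1≤p , p≤M) ∷ ps∈) with search o p (N ∸ p) in found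
    ... | nothing = stuck (circularPark-monotone N _ ps N-taken)
      where
      N-taken : occupied N (parkSpot o p ∷ o) ≡ true
      N-taken rewrite parkSpot-search-fails o p 1≤p p≤M N-free found | ≡ᵇ-refl N = refl
    ... | just s with parkFrom M (s ∷ o) ps | linear≈circular (s ∷ o) ps N-still-free ps∈
      where
      s<N : s < N
      s<N = subst (s <_) (m+[n∸m]≡n (m≤n⇒m≤1+n p≤M)) (proj₂ (search-bounds o p (N ∸ p) s found))
      N-still-free : occupied N (s ∷ o) ≡ false
      N-still-free rewrite ≢⇒≡ᵇ-false {N} {s} (λ N≡s → <-irrefl (sym N≡s) s<N) = N-free
    ...   | nothing | stuck N-taken = stuck (subst (λ u → occupied N (circularPark (u ∷ o) ps) ≡ true) spot≡s N-taken)
      where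
      spot≡s : s ≡ parkSpot o p
      spot≡s = sym (parkSpot-search o p s 1≤p p≤M found)
    ...   | just ss | parked same-unlucky N-free′ =
          parked (trans (countDiff-∷ p s ps ss (occupied p o) (search-lucky o p (N ∸ p) s found))
                        (cong (bit (occupied p o) +_) (subst (λ u → countDiff ps ss ≡ circularUnlucky (u ∷ o) ps) spot≡s same-unlucky)))
                 (subst (λ u → occupied N (circularPark (u ∷ o) ps) ≡ false) spot≡s N-free′)
      where
      spot≡s : s ≡ parkSpot o p
      spot≡s = sym (parkSpot-search o p s 1≤p p≤M found)


module BigOperators {c ℓ : Level} (R : CommutativeSemiring c ℓ) where

  open import Data.Nat using (zero; suc; _≡ᵇ_; s≤s)
  open import Data.Bool using (Bool; true; false; if_then_else_; _∨_)
  open import Data.Bool.Properties using (∨-zeroʳ)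
  open import Data.Bool.ListAction using (any)
  open import Data.List using (List; []; map; _++_; length; reverse; [_]; concat; concatMap; filter)
  open import Data.List.Properties using (map-∘; unfold-reverse)
  open import Data.List.Relation.Unary.All using (All; []; _∷_)
  open import Function using (_∘_)
  open import Data.Product using (_,_)
  open import Relation.Binary.PropositionalEquality as ≡ using (_≡_)
  open Parking using (InRange; oneTo-inRange; oneTo-suc; oneTo-∷ʳ; ≡ᵇ-refl)
  open CommutativeSemiring R
  open Poly R using (sumL; nat; prodTo)
  open import Algebra.Properties.CommutativeSemigroup +-commutativeSemigroup using () renaming (interchange to +-interchange)
  open import Relation.Binary.Reasoning.Setoid setoid

  private variable
    A B : Set

  ∑ : List A → (A → Carrier) → Carrier
  ∑ L f = sumL (map f L)

  ∑-map : (L : List A) (g : A → B) (f : B → Carrier) → ∑ (map g L) f ≡ ∑ L (f ∘ g)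
  ∑-map L g f = ≡.cong sumL (≡.sym (map-∘ L))

  ∑-++ : (L M : List A) (f : A → Carrier) → ∑ (L ++ M) f ≈ ∑ L f + ∑ M f
  ∑-++ [] M f = sym (+-identityˡ _)
  ∑-++ (a ∷ L) M f = trans (+-congˡ (∑-++ L M f)) (sym (+-assoc _ _ _))

  ∑-cong : (L : List A) {f g : A → Carrier} → (∀ a → f a ≈ g a) → ∑ L f ≈ ∑ L g
  ∑-cong [] f≈g = refl
  ∑-cong (a ∷ L) f≈g = +-cong (f≈g a) (∑-cong L f≈g)

  ∑-cong-All : {P : A → Set} {L : List A} {f g : A → Carrier} → All P L → (∀ a → P a → f a ≈ g a) → ∑ L f ≈ ∑ L g
  ∑-cong-All [] f≈g = refl
  ∑-cong-All (Pa ∷ PL) f≈g = +-cong (f≈g _ Pa) (∑-cong-All PL f≈g)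

  ∑-+ : (L : List A) (f g : A → Carrier) → ∑ L (λ a → f a + g a) ≈ ∑ L f + ∑ L g
  ∑-+ [] f g = sym (+-identityˡ _)
  ∑-+ (a ∷ L) f g = trans (+-congˡ (∑-+ L f g)) (+-interchange (f a) (g a) (∑ L f) (∑ L g))

  ∑-*ˡ : (L : List A) (w : Carrier) (f : A → Carrier) → ∑ L (λ a → w * f a) ≈ w * ∑ L f
  ∑-*ˡ [] w f = sym (zeroʳ w)
  ∑-*ˡ (a ∷ L) w f = trans (+-congˡ (∑-*ˡ L w f)) (sym (distribˡ w _ _))

  ∑-*ʳ : (L : List A) (w : Carrier) (f : A → Carrier) → ∑ L (λ a → f a * w) ≈ ∑ L f * w
  ∑-*ʳ [] w f = sym (zeroˡ w)
  ∑-*ʳ (a ∷ L) w f = trans (+-congˡ (∑-*ʳ L w f)) (sym (distribʳ w _ _))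

  ∑-0 : (L : List A) → ∑ L (λ _ → 0#) ≈ 0#
  ∑-0 [] = refl
  ∑-0 (a ∷ L) = trans (+-identityˡ _) (∑-0 L)

  ∑-comm : (L : List A) (S : List B) (F : A → B → Carrier) → ∑ L (λ a → ∑ S (F a)) ≈ ∑ S (λ s → ∑ L (λ a → F a s))
  ∑-comm [] S F = sym (∑-0 S)
  ∑-comm (a ∷ L) S F = trans (+-congˡ (∑-comm L S F)) (sym (∑-+ S (F a) _))

  nat-suc-* : ∀ k w → nat (suc k) * w ≈ w + nat k * w
  nat-suc-* k w = trans (distribʳ w 1# (nat k)) (+-congʳ (*-identityˡ w))

  nat-1-* : ∀ w → nat 1 * w ≈ w
  nat-1-* w = trans (*-congʳ (+-identityʳ 1#)) (*-identityˡ w)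

  ∑-const : (L : List A) (w : Carrier) → ∑ L (λ _ → w) ≈ nat (length L) * w
  ∑-const [] w = sym (zeroˡ w)
  ∑-const (a ∷ L) w = trans (+-congˡ (∑-const L w)) (sym (nat-suc-* (length L) w))

  ∑-indicator : (L : List ℕ) (f : ℕ → Bool) (w : Carrier) → ∑ L (λ a → if f a then w else 0#) ≈ nat (count f L) * w
  ∑-indicator [] f w = sym (zeroˡ w)
  ∑-indicator (a ∷ L) f w with f a
  ... | true = trans (+-congˡ (∑-indicator L f w)) (sym (nat-suc-* (count f L) w))
  ... | false = trans (+-identityˡ _) (∑-indicator L f w)

  ∑-reverse : (L : List A) (f : A → Carrier) → ∑ (reverse L) f ≈ ∑ L f
  ∑-reverse [] f = refl
  ∑-reverse (a ∷ L) f = begin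
    ∑ (reverse (a ∷ L)) f        ≡⟨ ≡.cong (λ u → ∑ u f) (unfold-reverse a L) ⟩
    ∑ (reverse L ++ [ a ]) f     ≈⟨ ∑-++ (reverse L) [ a ] f ⟩
    ∑ (reverse L) f + (f a + 0#) ≈⟨ +-cong (∑-reverse L f) (+-identityʳ _) ⟩
    ∑ L f + f a                  ≈⟨ +-comm _ _ ⟩
    f a + ∑ L f                  ∎

  ∑-concatMap : (L : List A) (g : A → List B) (f : B → Carrier) → ∑ (concatMap g L) f ≈ ∑ L (λ a → ∑ (g a) f)
  ∑-concatMap [] g f = refl
  ∑-concatMap (a ∷ L) g f = trans (∑-++ (g a) (concat (map g L)) f) (+-congˡ (∑-concatMap L g f))

  ∑-filter : (L : List A) (keep : A → Bool) (f : A → Carrier) →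
    sumL (map f (filter (λ a → Data.Bool.T? (keep a)) L)) ≈ ∑ L (λ a → if keep a then f a else 0#)
  ∑-filter [] keep f = refl
  ∑-filter (a ∷ L) keep f with keep a
  ... | true = +-congˡ (∑-filter L keep f)
  ... | false = trans (∑-filter L keep f) (sym (+-identityˡ _))

  ∏< : ℕ → (ℕ → Carrier) → Carrier
  ∏< zero g = 1#
  ∏< (suc k) g = g 0 * ∏< k (g ∘ suc)

  ∏<-cong : ∀ k {g h} → (∀ j → g j ≈ h j) → ∏< k g ≈ ∏< k h
  ∏<-cong zero g≈h = refl
  ∏<-cong (suc k) g≈h = *-cong (g≈h 0) (∏<-cong k (g≈h ∘ suc))

  ∏<-suc≈prodTo : ∀ k f → ∏< k (f ∘ suc) ≈ prodTo k f
  ∏<-suc≈prodTo zero f = refl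
  ∏<-suc≈prodTo (suc k) f = begin
    f 1 * ∏< k (f ∘ suc ∘ suc)    ≈⟨ *-congˡ (∏<-suc≈prodTo k (f ∘ suc)) ⟩
    f 1 * prodTo k (f ∘ suc)      ≈⟨ prodTo-peel k ⟨
    prodTo (suc k) f              ∎
    where
    prodTo-peel : ∀ k → prodTo (suc k) f ≈ f 1 * prodTo k (f ∘ suc)
    prodTo-peel zero = trans (*-identityˡ _) (sym (*-identityʳ _))
    prodTo-peel (suc k) = trans (*-congʳ (prodTo-peel k)) (*-assoc _ _ _)

  ∑-seqs-suc : ∀ K k f → ∑ (seqs K (suc k)) f ≈ ∑ (oneTo K) (λ a → ∑ (seqs K k) (λ r → f (a ∷ r)))
  ∑-seqs-suc K k f = trans (∑-concatMap (oneTo K) (λ a → map (a ∷_) (seqs K k)) f)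
                           (∑-cong (oneTo K) (λ a → reflexive (∑-map (seqs K k) (a ∷_) f)))

  ∑-seqs-cong : ∀ K k {f g} → (∀ σ → All (InRange K) σ → length σ ≡ k → f σ ≈ g σ) → ∑ (seqs K k) f ≈ ∑ (seqs K k) g
  ∑-seqs-cong K zero f≈g = +-congʳ (f≈g [] [] ≡.refl)
  ∑-seqs-cong K (suc k) {f} {g} f≈g = begin
    ∑ (seqs K (suc k)) f                                ≈⟨ ∑-seqs-suc K k f ⟩
    ∑ (oneTo K) (λ a → ∑ (seqs K k) (λ r → f (a ∷ r))) ≈⟨ ∑-cong-All (oneTo-inRange K) (λ a a∈ →
                                                            ∑-seqs-cong K k (λ σ σ∈ len → f≈g (a ∷ σ) (a∈ ∷ σ∈) (≡.cong suc len))) ⟩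
    ∑ (oneTo K) (λ a → ∑ (seqs K k) (λ r → g (a ∷ r))) ≈⟨ ∑-seqs-suc K k g ⟨
    ∑ (seqs K (suc k)) g                                ∎

  ∑-seqs-drop-top : ∀ K k f → (∀ σ → any (suc K ≡ᵇ_) σ ≡ true → f σ ≈ 0#) → ∑ (seqs (suc K) k) f ≈ ∑ (seqs K k) f
  ∑-seqs-drop-top K zero f _ = refl
  ∑-seqs-drop-top K (suc k) f vanish = begin
    ∑ (seqs (suc K) (suc k)) f                                   ≈⟨ ∑-seqs-suc (suc K) k f ⟩
    ∑ (oneTo (suc K)) tails                                      ≡⟨ ≡.cong (λ u → ∑ u tails) (oneTo-∷ʳ K) ⟩
    ∑ (oneTo K ++ [ suc K ]) tails                               ≈⟨ ∑-++ (oneTo K) [ suc K ] tails ⟩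
    ∑ (oneTo K) tails + (tails (suc K) + 0#)                     ≈⟨ +-cong (∑-cong (oneTo K) drop-top) (+-identityʳ _) ⟩
    ∑ (oneTo K) (λ a → ∑ (seqs K k) (λ r → f (a ∷ r))) + tails (suc K) ≈⟨ +-congˡ top-vanishes ⟩
    ∑ (oneTo K) (λ a → ∑ (seqs K k) (λ r → f (a ∷ r))) + 0#     ≈⟨ +-identityʳ _ ⟩
    ∑ (oneTo K) (λ a → ∑ (seqs K k) (λ r → f (a ∷ r)))          ≈⟨ ∑-seqs-suc K k f ⟨
    ∑ (seqs K (suc k)) f                                          ∎
    where
    tails : ℕ → Carrier
    tails a = ∑ (seqs (suc K) k) (λ r → f (a ∷ r))
    drop-top : ∀ a → tails a ≈ ∑ (seqs K k) (λ r → f (a ∷ r))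
    drop-top a = ∑-seqs-drop-top K k (λ r → f (a ∷ r))
                   (λ σ top∈σ → vanish (a ∷ σ) (≡.trans (≡.cong (_ ∨_) top∈σ) (∨-zeroʳ _)))
    top-vanishes : tails (suc K) ≈ 0#
    top-vanishes = trans (∑-cong (seqs (suc K) k) (λ r → vanish (suc K ∷ r) (≡.cong (_∨ any (suc K ≡ᵇ_) r) (≡ᵇ-refl K))))
                         (∑-0 (seqs (suc K) k))

  module _ (M : ℕ) where
    open Parking.Circle M using (N; rotate; rotate-N; rotate-<N)

    ∑-oneTo-rotate : ∀ h → ∑ (oneTo N) (h ∘ rotate) ≈ ∑ (oneTo N) h
    ∑-oneTo-rotate h = begin
      ∑ (oneTo N) (h ∘ rotate)                 ≡⟨ ≡.cong (λ u → ∑ u (h ∘ rotate)) (oneTo-∷ʳ M) ⟩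
      ∑ (oneTo M ++ [ N ]) (h ∘ rotate)        ≈⟨ ∑-++ (oneTo M) [ N ] (h ∘ rotate) ⟩
      ∑ (oneTo M) (h ∘ rotate) + (h (rotate N) + 0#)
        ≈⟨ +-cong (∑-cong-All (oneTo-inRange M) (λ a (1≤a , a≤M) → reflexive (≡.cong h (rotate-<N a 1≤a (s≤s a≤M)))))
                  (+-identityʳ _) ⟩
      ∑ (oneTo M) (h ∘ suc) + h (rotate N)     ≡⟨ ≡.cong (λ u → ∑ (oneTo M) (h ∘ suc) + h u) rotate-N ⟩
      ∑ (oneTo M) (h ∘ suc) + h 1              ≈⟨ +-comm _ _ ⟩
      h 1 + ∑ (oneTo M) (h ∘ suc)              ≡⟨ ≡.cong (h 1 +_) (∑-map (oneTo M) suc h) ⟨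
      ∑ (1 ∷ map suc (oneTo M)) h              ≡⟨ ≡.cong (λ u → ∑ u h) (oneTo-suc M) ⟨
      ∑ (oneTo N) h                            ∎

    ∑-seqs-rotate : ∀ k f → ∑ (seqs N k) (f ∘ map rotate) ≈ ∑ (seqs N k) f
    ∑-seqs-rotate zero f = refl
    ∑-seqs-rotate (suc k) f = begin
      ∑ (seqs N (suc k)) (f ∘ map rotate)                                 ≈⟨ ∑-seqs-suc N k _ ⟩
      ∑ (oneTo N) (λ a → ∑ (seqs N k) (λ r → f (rotate a ∷ map rotate r)))
        ≈⟨ ∑-cong (oneTo N) (λ a → ∑-seqs-rotate k (λ r → f (rotate a ∷ r))) ⟩
      ∑ (oneTo N) (λ a → ∑ (seqs N k) (λ r → f (rotate a ∷ r)))
        ≈⟨ ∑-oneTo-rotate (λ a → ∑ (seqs N k) (λ r → f (a ∷ r))) ⟩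
      ∑ (oneTo N) (λ a → ∑ (seqs N k) (λ r → f (a ∷ r)))                   ≈⟨ ∑-seqs-suc N k f ⟨
      ∑ (seqs N (suc k)) f                                                 ∎

module Enumeration {c ℓ : Level} (R : CommutativeSemiring c ℓ) (m : ℕ) (x y z : CommutativeSemiring.Carrier R) where

  open import Data.Nat as ℕ using (zero; _∸_; _≡ᵇ_; _<_; z≤n; s≤s)
  import Data.Nat.Properties as ℕ
  open import Data.Bool using (Bool; true; false; if_then_else_; not; _∧_; _∨_)
  open import Data.Bool.ListAction using (any)
  open import Data.Maybe using (just; nothing)
  open import Data.List using (List; []; map; length; upTo; reverse)
  open import Data.List.Relation.Unary.All using (All; []; _∷_)
  import Data.List.Relation.Unary.All.Properties as All
  open import Data.Empty using (⊥-elim)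
  open import Data.Product using (_×_; _,_)
  open import Data.Unit using (tt)
  open import Function using (_∘_; id)
  open import Relation.Binary.PropositionalEquality as ≡ using (_≡_; _≢_)
  open CommutativeSemiring R
  open Poly R using (_^_; nat; genPF; rhs; prodTo)
  open BigOperators R
  open Parking
  open import Relation.Binary.Reasoning.Setoid setoid
  open import Algebra.Properties.Semiring.Exp semiring using (^-homo-*)
  open import Algebra.Solver.Ring.NaturalCoefficients.Default R

  M : ℕ
  M = suc (suc m)

  open Circle M

  weight : List ℕ → Carrier
  weight σ = x ^ lel σ * y ^ nlel σ * z ^ circularUnlucky [] σ

  indicator : Bool → Carrier → Carrier
  indicator b w = if b then w else 0#

  weightIfFree : ℕ → List ℕ → Carrier
  weightIfFree t σ = indicator (not (occupied t (circularPark [] σ))) (weight σ)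

  linear-weight : ∀ σ → All (InRange M) σ →
    (if parks M σ then x ^ lel σ * y ^ nlel σ * z ^ unl M σ else 0#) ≈ weightIfFree N σ
  linear-weight σ σ∈ with park M σ | linear≈circular [] σ ≡.refl σ∈
  ... | just ss | parked same-unlucky N-free rewrite same-unlucky | N-free = refl
  ... | nothing | stuck N-taken rewrite N-taken = refl

  genPF≈∑-N-free : genPF M x y z ≈ ∑ (seqs N M) (weightIfFree N)
  genPF≈∑-N-free = begin
    genPF M x y z                                 ≈⟨ ∑-filter (seqs M M) (parks M) _ ⟩
    ∑ (seqs M M) (λ σ → if parks M σ then _ else 0#) ≈⟨ ∑-seqs-cong M M (λ σ σ∈ _ → linear-weight σ σ∈) ⟩
    ∑ (seqs M M) (weightIfFree N)                 ≈⟨ ∑-seqs-drop-top M M (weightIfFree N) N-taken ⟨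
    ∑ (seqs N M) (weightIfFree N)                 ∎
    where
    N-taken : ∀ σ → any (N ≡ᵇ_) σ ≡ true → weightIfFree N σ ≈ 0#
    N-taken σ N∈σ rewrite preferring-N-occupies-N [] σ N∈σ = refl

  freeSum : ℕ → ℕ → Carrier
  freeSum a t = ∑ (seqs N (suc m)) (λ r → weightIfFree t (a ∷ r))

  weightIfFree-rotate : ∀ t σ → weightIfFree (rotate t) (map rotate σ) ≡ weightIfFree t σ
  weightIfFree-rotate t σ rewrite circularPark-rotate [] σ | occupied-rotate t (circularPark [] σ)
                                | lel-rotate σ | nlel-rotate σ | circularUnlucky-rotate [] σ = ≡.refl

  freeSum-rotate^ : ∀ j a t → freeSum (rotate^ j a) (rotate^ j t) ≈ freeSum a t
  freeSum-rotate^ zero a t = refl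
  freeSum-rotate^ (suc j) a t = trans (freeSum-rotate (rotate^ j a) (rotate^ j t)) (freeSum-rotate^ j a t)
    where
    freeSum-rotate : ∀ a t → freeSum (rotate a) (rotate t) ≈ freeSum a t
    freeSum-rotate a t = trans (sym (∑-seqs-rotate M (suc m) (λ r → weightIfFree (rotate t) (rotate a ∷ r))))
                               (∑-cong (seqs N (suc m)) (λ r → reflexive (weightIfFree-rotate t (a ∷ r))))

  -- Rotating by j carries (1, N - j) to (j + 1, N), and N - j runs over all spots as j does.
  ∑-freeSum-N≈∑-freeSum-1 : ∑ (oneTo N) (λ a → freeSum a N) ≈ ∑ (oneTo N) (freeSum 1)
  ∑-freeSum-N≈∑-freeSum-1 = begin
    ∑ (map suc (upTo N)) (λ a → freeSum a N) ≡⟨ ∑-map (upTo N) suc (λ a → freeSum a N) ⟩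
    ∑ (upTo N) (λ j → freeSum (suc j) N)     ≈⟨ ∑-cong-All (All.applyUpTo⁺₁ id N id) (λ j j<N → sym (rotate-by j j<N)) ⟩
    ∑ (upTo N) (λ j → freeSum 1 (N ∸ j))     ≡⟨ ∑-map (upTo N) (N ∸_) (freeSum 1) ⟨
    ∑ (map (N ∸_) (upTo N)) (freeSum 1)      ≡⟨ ≡.cong (λ u → ∑ u (freeSum 1)) (upTo-reflect N) ⟩
    ∑ (reverse (oneTo N)) (freeSum 1)        ≈⟨ ∑-reverse (oneTo N) (freeSum 1) ⟩
    ∑ (oneTo N) (freeSum 1)                  ∎
    where
    rotate-by : ∀ j → j < N → freeSum 1 (N ∸ j) ≈ freeSum (suc j) N
    rotate-by j j<N = trans (sym (freeSum-rotate^ j 1 (N ∸ j))) (reflexive (≡.cong₂ freeSum 1↦j+1 N∸j↦N))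
      where
      1↦j+1 : rotate^ j 1 ≡ suc j
      1↦j+1 = rotate^-without-wrap j 1 (s≤s z≤n) j<N
      N∸j↦N : rotate^ j (N ∸ j) ≡ N
      N∸j↦N = ≡.trans (rotate^-without-wrap j (N ∸ j) (ℕ.m<n⇒0<n∸m j<N) (ℕ.≤-reflexive (ℕ.m∸n+n≡m (ℕ.<⇒≤ j<N))))
                      (ℕ.m∸n+n≡m (ℕ.<⇒≤ j<N))

  exactly-one-free : ∀ r → All (InRange N) r → length r ≡ suc m →
    count (λ t → not (occupied t (circularPark [] (1 ∷ r)))) (oneTo N) ≡ 1
  exactly-one-free r r∈ len with circularPark-valid [] (1 ∷ r) (tt , []) ((s≤s z≤n , s≤s z≤n) ∷ r∈) fits
    where
    fits : suc (length r) ℕ.≤ N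
    fits rewrite len = ℕ.n≤1+n M
  ... | (distinct , in-range) , parked-all =
    ≡.trans (count-free-oneTo N _ distinct in-range)
            (≡.trans (≡.cong (N ∸_) (≡.trans parked-all (≡.cong suc len))) (ℕ.m+n∸n≡m 1 M))

  ∑-freeSum-1≈∑-prefers-1 : ∑ (oneTo N) (freeSum 1) ≈ ∑ (seqs N (suc m)) (λ r → weight (1 ∷ r))
  ∑-freeSum-1≈∑-prefers-1 = trans (∑-comm (oneTo N) (seqs N (suc m)) (λ t r → weightIfFree t (1 ∷ r)))
                                  (∑-seqs-cong N (suc m) one-free-spot)
    where
    one-free-spot : ∀ r → All (InRange N) r → length r ≡ suc m → ∑ (oneTo N) (λ t → weightIfFree t (1 ∷ r)) ≈ weight (1 ∷ r)
    one-free-spot r r∈ len = begin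
      ∑ (oneTo N) (λ t → weightIfFree t (1 ∷ r))    ≈⟨ ∑-indicator (oneTo N) free (weight (1 ∷ r)) ⟩
      nat (count free (oneTo N)) * weight (1 ∷ r)   ≡⟨ ≡.cong (λ k → nat k * weight (1 ∷ r)) (exactly-one-free r r∈ len) ⟩
      nat 1 * weight (1 ∷ r)                        ≈⟨ nat-1-* _ ⟩
      weight (1 ∷ r)                                ∎
      where
      free : ℕ → Bool
      free t = not (occupied t (circularPark [] (1 ∷ r)))

  prefixWeight : ℕ → ℕ → List ℕ → List ℕ → Carrier
  prefixWeight a b o r = x ^ count (a ≡ᵇ_) r * y ^ count (b ≡ᵇ_) r * z ^ circularUnlucky o r

  carWeight : ℕ → ℕ → List ℕ → ℕ → Carrier
  carWeight a b o p = x ^ bit (a ≡ᵇ p) * y ^ bit (b ≡ᵇ p) * z ^ bit (occupied p o)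

  prefixWeight-∷ : ∀ a b o p r → prefixWeight a b o (p ∷ r) ≈ carWeight a b o p * prefixWeight a b (parkSpot o p ∷ o) r
  prefixWeight-∷ a b o p r = begin
    prefixWeight a b o (p ∷ r)                               ≡⟨ ≡.cong₂ (λ i j → x ^ i * y ^ j * z ^ (γ ℕ.+ Z))
                                                                        (count-∷ (a ≡ᵇ_) p r) (count-∷ (b ≡ᵇ_) p r) ⟩
    x ^ (α ℕ.+ X) * y ^ (β ℕ.+ Y) * z ^ (γ ℕ.+ Z)            ≈⟨ *-cong (*-cong (^-homo-* x α X) (^-homo-* y β Y)) (^-homo-* z γ Z) ⟩
    (x ^ α * x ^ X) * (y ^ β * y ^ Y) * (z ^ γ * z ^ Z)      ≈⟨ solve 6 (λ a₁ a₂ b₁ b₂ c₁ c₂ →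
                                                                  (a₁ :* a₂) :* (b₁ :* b₂) :* (c₁ :* c₂) := (a₁ :* b₁ :* c₁) :* (a₂ :* b₂ :* c₂))
                                                                  refl _ _ _ _ _ _ ⟩
    carWeight a b o p * prefixWeight a b (parkSpot o p ∷ o) r ∎
    where
    α β γ X Y Z : ℕ
    α = bit (a ≡ᵇ p)
    β = bit (b ≡ᵇ p)
    γ = bit (occupied p o)
    X = count (a ≡ᵇ_) r
    Y = count (b ≡ᵇ_) r
    Z = circularUnlucky (parkSpot o p ∷ o) r

  carWeight-split₁ : ∀ a b o → occupied a o ≡ true → occupied b o ≡ true → a ≢ b → ∀ p →
    carWeight a b o p ≈ indicator (a ≡ᵇ p) (x * z) + indicator (b ≡ᵇ p) (y * z)
                        + indicator ((occupied p o ∧ not (a ≡ᵇ p)) ∧ not (b ≡ᵇ p)) z + indicator (not (occupied p o)) 1#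
  carWeight-split₁ a b o a∈o b∈o a≢b p with a ≡ᵇ p in a≡p | b ≡ᵇ p in b≡p | occupied p o in p∈o
  ... | true  | true  | _     = ⊥-elim (a≢b (≡.trans (≡ᵇ-true⇒≡ a p a≡p) (≡.sym (≡ᵇ-true⇒≡ b p b≡p))))
  ... | true  | false | false with () ← ≡.trans (≡.sym p∈o) (occupied-≡ᵇ a p o a≡p a∈o)
  ... | false | true  | false with () ← ≡.trans (≡.sym p∈o) (occupied-≡ᵇ b p o b≡p b∈o)
  ... | true  | false | true  = solve 2 (λ x z → x :^ 1 :* con 1 :* z :^ 1 := x :* z :+ con 0 :+ con 0 :+ con 0) refl x z
  ... | false | true  | true  = solve 2 (λ y z → con 1 :* y :^ 1 :* z :^ 1 := con 0 :+ y :* z :+ con 0 :+ con 0) refl y z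
  ... | false | false | true  = solve 1 (λ z → con 1 :* con 1 :* z :^ 1 := con 0 :+ con 0 :+ z :+ con 0) refl z
  ... | false | false | false = solve 0 (con 1 :* con 1 :* con 1 := con 0 :+ con 0 :+ con 0 :+ con 1) refl

  carWeight-split₂ : ∀ a o → occupied a o ≡ true → ∀ p →
    carWeight a a o p ≈ indicator (a ≡ᵇ p) (x * y * z) + indicator (occupied p o ∧ not (a ≡ᵇ p)) z + indicator (not (occupied p o)) 1#
  carWeight-split₂ a o a∈o p with a ≡ᵇ p in a≡p | occupied p o in p∈o
  ... | true  | false with () ← ≡.trans (≡.sym p∈o) (occupied-≡ᵇ a p o a≡p a∈o)
  ... | true  | true  = solve 3 (λ x y z → x :^ 1 :* y :^ 1 :* z :^ 1 := x :* y :* z :+ con 0 :+ con 0) refl x y z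
  ... | false | true  = solve 1 (λ z → con 1 :* con 1 :* z :^ 1 := con 0 :+ z :+ con 0) refl z
  ... | false | false = solve 0 (con 1 :* con 1 :* con 1 := con 0 :+ con 0 :+ con 1) refl

  ∑-indicator-oneTo : ∀ f w k → count f (oneTo N) ≡ k → ∑ (oneTo N) (λ p → indicator (f p) w) ≈ nat k * w
  ∑-indicator-oneTo f w k counted = trans (∑-indicator (oneTo N) f w) (reflexive (≡.cong (λ j → nat j * w) counted))

  Admissible : ℕ → ℕ → List ℕ → Set
  Admissible a b o = ValidOccupancy o × occupied a o ≡ true × occupied b o ≡ true

  Admissible-step : ∀ a b o p → Admissible a b o → length o < N → InRange N p → Admissible a b (parkSpot o p ∷ o)
  Admissible-step a b o p (valid@(o-distinct , o∈) , a∈o , b∈o) o<N p∈ =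
    let s∈ , s-free = parkSpot-free o p valid o<N p∈
    in ((s-free , o-distinct) , (s∈ ∷ o∈)) , occupied-∷ a _ o a∈o , occupied-∷ b _ o b∈o

  factor₁ : ℕ → Carrier
  factor₁ L = x * z + y * z + nat (L ∸ 2) * z + nat (N ∸ L)

  factor₂ : ℕ → Carrier
  factor₂ L = x * y * z + nat (L ∸ 1) * z + nat (N ∸ L)

  ∑-carWeight₁ : ∀ a b o → a ≢ b → Admissible a b o → ∑ (oneTo N) (carWeight a b o) ≈ factor₁ (length o)
  ∑-carWeight₁ a b o a≢b (valid@(o-distinct , o∈) , a∈o , b∈o) = begin
    ∑ (oneTo N) (carWeight a b o)                                  ≈⟨ ∑-cong (oneTo N) (carWeight-split₁ a b o a∈o b∈o a≢b) ⟩
    ∑ (oneTo N) (λ p → A p + B p + C p + D p)                      ≈⟨ ∑-+ (oneTo N) _ D ⟩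
    ∑ (oneTo N) (λ p → A p + B p + C p) + ∑ (oneTo N) D
      ≈⟨ +-congʳ (trans (∑-+ (oneTo N) _ C) (+-congʳ (∑-+ (oneTo N) A B))) ⟩
    ∑ (oneTo N) A + ∑ (oneTo N) B + ∑ (oneTo N) C + ∑ (oneTo N) D
      ≈⟨ +-cong (+-cong (+-cong (trans (∑-indicator-oneTo _ _ 1 (count-≡ᵇ-oneTo N a (occupied⇒inRange a o a∈o o∈))) (nat-1-* _))
                                    (trans (∑-indicator-oneTo _ _ 1 (count-≡ᵇ-oneTo N b (occupied⇒inRange b o b∈o o∈))) (nat-1-* _)))
                          (∑-indicator-oneTo _ _ _ (count-occupied-except₂ N o a b o-distinct o∈ a∈o b∈o a≢b)))
                (trans (∑-indicator-oneTo _ _ _ (count-free-oneTo N o o-distinct o∈)) (*-identityʳ _)) ⟩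
    factor₁ (length o)                                              ∎
    where
    A B C D : ℕ → Carrier
    A p = indicator (a ≡ᵇ p) (x * z)
    B p = indicator (b ≡ᵇ p) (y * z)
    C p = indicator ((occupied p o ∧ not (a ≡ᵇ p)) ∧ not (b ≡ᵇ p)) z
    D p = indicator (not (occupied p o)) 1#

  ∑-carWeight₂ : ∀ a o → Admissible a a o → ∑ (oneTo N) (carWeight a a o) ≈ factor₂ (length o)
  ∑-carWeight₂ a o (valid@(o-distinct , o∈) , a∈o , _) = begin
    ∑ (oneTo N) (carWeight a a o)                        ≈⟨ ∑-cong (oneTo N) (carWeight-split₂ a o a∈o) ⟩
    ∑ (oneTo N) (λ p → A p + C p + D p)                  ≈⟨ ∑-+ (oneTo N) _ D ⟩
    ∑ (oneTo N) (λ p → A p + C p) + ∑ (oneTo N) D        ≈⟨ +-congʳ (∑-+ (oneTo N) A C) ⟩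
    ∑ (oneTo N) A + ∑ (oneTo N) C + ∑ (oneTo N) D
      ≈⟨ +-cong (+-cong (trans (∑-indicator-oneTo _ _ 1 (count-≡ᵇ-oneTo N a (occupied⇒inRange a o a∈o o∈))) (nat-1-* _))
                        (∑-indicator-oneTo _ _ _ (count-occupied-except N o a o-distinct o∈ a∈o)))
                (trans (∑-indicator-oneTo _ _ _ (count-free-oneTo N o o-distinct o∈)) (*-identityʳ _)) ⟩
    factor₂ (length o)                                    ∎
    where
    A C D : ℕ → Carrier
    A p = indicator (a ≡ᵇ p) (x * y * z)
    C p = indicator (occupied p o ∧ not (a ≡ᵇ p)) z
    D p = indicator (not (occupied p o)) 1#

  ∑-prefixWeight : ∀ a b (factor : ℕ → Carrier) → (∀ o → Admissible a b o → ∑ (oneTo N) (carWeight a b o) ≈ factor (length o)) →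
    ∀ k o → Admissible a b o → length o ℕ.+ k < N → ∑ (seqs N k) (prefixWeight a b o) ≈ ∏< k (λ j → factor (length o ℕ.+ j))
  ∑-prefixWeight a b factor ∑-car zero o _ _ = trans (+-identityʳ _) (trans (*-identityʳ _) (*-identityʳ _))
  ∑-prefixWeight a b factor ∑-car (suc k) o adm fits = begin
    ∑ (seqs N (suc k)) (prefixWeight a b o)                             ≈⟨ ∑-seqs-suc N k _ ⟩
    ∑ (oneTo N) (λ p → ∑ (seqs N k) (λ r → prefixWeight a b o (p ∷ r))) ≈⟨ ∑-cong-All (oneTo-inRange N) next-car ⟩
    ∑ (oneTo N) (λ p → carWeight a b o p * rest)                        ≈⟨ ∑-*ʳ (oneTo N) rest (carWeight a b o) ⟩
    ∑ (oneTo N) (carWeight a b o) * rest                                ≈⟨ *-congʳ (∑-car o adm) ⟩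
    factor (length o) * rest                                            ≡⟨ ≡.cong (λ i → factor i * rest) (ℕ.+-identityʳ _) ⟨
    factor (length o ℕ.+ 0) * rest                                      ∎
    where
    rest : Carrier
    rest = ∏< k (λ j → factor (length o ℕ.+ suc j))
    next-car : ∀ p → InRange N p → ∑ (seqs N k) (λ r → prefixWeight a b o (p ∷ r)) ≈ carWeight a b o p * rest
    next-car p p∈ = begin
      ∑ (seqs N k) (λ r → prefixWeight a b o (p ∷ r))
        ≈⟨ ∑-cong (seqs N k) (prefixWeight-∷ a b o p) ⟩
      ∑ (seqs N k) (λ r → carWeight a b o p * prefixWeight a b (parkSpot o p ∷ o) r)
        ≈⟨ ∑-*ˡ (seqs N k) _ _ ⟩
      carWeight a b o p * ∑ (seqs N k) (prefixWeight a b (parkSpot o p ∷ o))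
        ≈⟨ *-congˡ (∑-prefixWeight a b factor ∑-car k _ (Admissible-step a b o p adm o<N p∈) fits′) ⟩
      carWeight a b o p * ∏< k (λ j → factor (suc (length o) ℕ.+ j))
        ≈⟨ *-congˡ (∏<-cong k (λ j → reflexive (≡.cong factor (≡.sym (ℕ.+-suc (length o) j))))) ⟩
      carWeight a b o p * rest                                                  ∎
      where
      o<N : length o < N
      o<N = ℕ.≤-<-trans (ℕ.m≤m+n (length o) (suc k)) fits
      fits′ : suc (length o) ℕ.+ k < N
      fits′ = ℕ.≤-trans (ℕ.≤-reflexive (≡.cong suc (≡.sym (ℕ.+-suc (length o) k)))) fits

  f₁ : ℕ → Carrier
  f₁ i = x * z + y * z + nat (i ∸ 1) * z + nat (M ∸ i)

  f₂ : ℕ → Carrier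
  f₂ i = x * y * z + nat i * z + nat (M ∸ i)

  ∑-prefers-1-1 : ∑ (seqs N m) (λ r → weight (1 ∷ 1 ∷ r)) ≈ x * y * (x * y * z) * prodTo m f₂
  ∑-prefers-1-1 = begin
    ∑ (seqs N m) (λ r → weight (1 ∷ 1 ∷ r))
      ≈⟨ ∑-cong (seqs N m) (λ r → solve 6 (λ x y z a b d →
           (x :* (x :* a)) :* (y :* (y :* b)) :* (z :* d) := (x :* y :* (x :* y :* z)) :* (a :* b :* d)) refl x y z _ _ _) ⟩
    ∑ (seqs N m) (λ r → x * y * (x * y * z) * prefixWeight 1 1 (2 ∷ 1 ∷ []) r) ≈⟨ ∑-*ˡ (seqs N m) _ _ ⟩
    x * y * (x * y * z) * ∑ (seqs N m) (prefixWeight 1 1 (2 ∷ 1 ∷ []))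
      ≈⟨ *-congˡ (∑-prefixWeight 1 1 factor₂ (λ o → ∑-carWeight₂ 1 o) m (2 ∷ 1 ∷ []) initial ℕ.≤-refl) ⟩
    x * y * (x * y * z) * ∏< m (f₂ ∘ suc)                      ≈⟨ *-congˡ (∏<-suc≈prodTo m f₂) ⟩
    x * y * (x * y * z) * prodTo m f₂                           ∎
    where
    initial : Admissible 1 1 (2 ∷ 1 ∷ [])
    initial = ((≡.refl , ≡.refl , tt) , ((s≤s z≤n , s≤s (s≤s z≤n)) ∷ (s≤s z≤n , s≤s z≤n) ∷ [])) , ≡.refl , ≡.refl

  ∑-prefers-1-b : ∀ c → InRange M c → ∑ (seqs N m) (λ r → weight (1 ∷ suc c ∷ r)) ≈ x * y * prodTo m f₁
  ∑-prefers-1-b (suc c) (_ , c<M) = begin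
    ∑ (seqs N m) (λ r → weight (1 ∷ b ∷ r))                    ≈⟨ ∑-cong (seqs N m) second-car ⟩
    ∑ (seqs N m) (λ r → x * y * prefixWeight 1 b (b ∷ 1 ∷ []) r) ≈⟨ ∑-*ˡ (seqs N m) _ _ ⟩
    x * y * ∑ (seqs N m) (prefixWeight 1 b (b ∷ 1 ∷ []))
      ≈⟨ *-congˡ (∑-prefixWeight 1 b factor₁ (λ o → ∑-carWeight₁ 1 b o λ ()) m (b ∷ 1 ∷ []) initial ℕ.≤-refl) ⟩
    x * y * ∏< m (f₁ ∘ suc)                                     ≈⟨ *-congˡ (∏<-suc≈prodTo m f₁) ⟩
    x * y * prodTo m f₁                                         ∎
    where
    b : ℕ
    b = suc (suc c)
    initial : Admissible 1 b (b ∷ 1 ∷ [])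
    initial = ((≡.refl , ≡.refl , tt) , ((s≤s z≤n , s≤s c<M) ∷ (s≤s z≤n , s≤s z≤n) ∷ [])) ,
              ≡.refl , ≡.cong (_∨ false) (≡ᵇ-refl b)
    second-car : ∀ r → weight (1 ∷ b ∷ r) ≈ x * y * prefixWeight 1 b (b ∷ 1 ∷ []) r
    second-car r rewrite count-∷ (b ≡ᵇ_) b r | ≡ᵇ-refl b =
      solve 6 (λ x y z a d e → (x :* a) :* (y :* d) :* e := x :* y :* (a :* d :* e)) refl x y z _ _ _

  ∑-prefers-1≈rhs : ∑ (seqs N (suc m)) (λ r → weight (1 ∷ r)) ≈ rhs M x y z
  ∑-prefers-1≈rhs = begin
    ∑ (seqs N (suc m)) (λ r → weight (1 ∷ r))           ≈⟨ ∑-seqs-suc N m _ ⟩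
    ∑ (oneTo N) second                                  ≡⟨ ≡.cong (λ u → ∑ u second) (oneTo-suc M) ⟩
    second 1 + ∑ (map suc (oneTo M)) second             ≡⟨ ≡.cong (second 1 +_) (∑-map (oneTo M) suc second) ⟩
    second 1 + ∑ (oneTo M) (second ∘ suc)               ≈⟨ +-cong ∑-prefers-1-1 (∑-cong-All (oneTo-inRange M) ∑-prefers-1-b) ⟩
    x * y * (x * y * z) * P₂ + ∑ (oneTo M) (λ _ → x * y * P₁) ≈⟨ +-congˡ (∑-const (oneTo M) _) ⟩
    x * y * (x * y * z) * P₂ + nat (length (oneTo M)) * (x * y * P₁)
      ≡⟨ ≡.cong (λ k → x * y * (x * y * z) * P₂ + nat k * (x * y * P₁)) (length-oneTo M) ⟩
    x * y * (x * y * z) * P₂ + nat M * (x * y * P₁)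
      ≈⟨ solve 6 (λ x y z p q k → x :* y :* (x :* y :* z) :* q :+ k :* (x :* y :* p) := x :* y :* (k :* p :+ x :* y :* z :* q))
                 refl x y z P₁ P₂ (nat M) ⟩
    rhs M x y z                                         ∎
    where
    second : ℕ → Carrier
    second b = ∑ (seqs N m) (λ r → weight (1 ∷ b ∷ r))
    P₁ P₂ : Carrier
    P₁ = prodTo m f₁
    P₂ = prodTo m f₂

theorem4p9 : {c ℓ : Level} (R : CommutativeSemiring c ℓ) (n : ℕ) → 2 ≤ n → (x y z : CommutativeSemiring.Carrier R) → CommutativeSemiring._≈_ R (Poly.genPF R n x y z) (Poly.rhs R n x y z)
theorem4p9 R (suc (suc m)) (s≤s (s≤s _)) x y z = begin
  genPF M x y z                              ≈⟨ genPF≈∑-N-free ⟩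
  ∑ (seqs N M) (weightIfFree N)              ≈⟨ ∑-seqs-suc N (suc m) (weightIfFree N) ⟩
  ∑ (oneTo N) (λ a → freeSum a N)            ≈⟨ ∑-freeSum-N≈∑-freeSum-1 ⟩
  ∑ (oneTo N) (freeSum 1)                    ≈⟨ ∑-freeSum-1≈∑-prefers-1 ⟩
  ∑ (seqs N (suc m)) (λ r → weight (1 ∷ r))  ≈⟨ ∑-prefers-1≈rhs ⟩
  rhs M x y z                                ∎
  where
  open CommutativeSemiring R using (setoid)
  open Poly R using (genPF; rhs)
  open BigOperators R using (∑; ∑-seqs-suc)
  open Enumeration R m x y z
  open Parking.Circle M using (N)
  open import Relation.Binary.Reasoning.Setoid setoid
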